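{- For integers $m\ge n\ge 1$, \[\mathrm{sat}_g(P_4;K_{m,n})=\begin{cases} n & \text{if $n$ is even},\\ m & \text{if $n$ is odd and $m$ is even},\\ m+\lfloor n/2\rfloor & \text{if $mn$ is odd,}\end{cases}\] and \[\mathrm{sat}_g'(P_4;K_{m,n})=\begin{cases} m & \text{if } n\le 2,\\ m+\lfloor n/2\rfloor & \text{if $n>2$ and $mn$ is even},\\ m+\lfloor n/2\rfloor-1 & \text{if $n>2$ and $mn$ is odd.}\end{cases}\]
   Context: Let $\mathcal{F}$ be a family of graphs and $H$ a host graph. A subgraph $G\subseteq H$ is $\mathcal{F}$-saturated relative to $H$ if no subgraph of $G$ belongs to $\mathcal{F}$ but adding any edge of $E(H)-E(G)$ to $G$ creates a subgraph in $\mathcal{F}$. In the $\mathcal{F}$-saturation game on $H$, two players Max and Min alternately add one edge of $H$ to a graph $G$ (initially with vertex set $V(H)$ and no edges), subject to $G$ never containing a subgraph in $\mathcal{F}$; the game ends when $G$ becomes $\mathcal{F}$-saturated relative to $H$. Max tries to maximize and Min to minimize the number of edges played. Under optimal play, the length of the game is denoted $\mathrm{sat}_g(\mathcal{F};H)$ when Max moves first and $\mathrm{sat}_g'(\mathcal{F};H)$ when Min moves first; when $\mathcal{F}=\{F\}$ we write $F$. $P_4$ is the path with $4$ vertices and $K_{m,n}$ the complete bipartite graph with parts of sizes $m$ and $n$. -}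

module Defs where

open import Data.Nat using (ℕ; zero; suc)
open import Data.Fin using (Fin; _≟_)
open import Data.Bool using (Bool; true; false; if_then_else_; _∧_)
open import Data.Sum using (_⊎_; inj₁; inj₂)
open import Data.Product using (_×_; _,_; ∃; ∃-syntax; Σ)
open import Data.Empty using (⊥)
open import Relation.Nullary using (¬_)
open import Relation.Nullary.Decidable using (⌊_⌋)
open import Relation.Binary.PropositionalEquality using (_≡_; _≢_)

-- The vertex set of
-- K_{m,n} is Fin m ⊎ Fin n (the two parts); every edge joins some
-- inj₁ i to some inj₂ j, so a subgraph is given by its edge indicator.
SubK : ℕ → ℕ → Set
SubK m n = Fin m → Fin n → Bool

emptyG : ∀ {m n} → SubK m n
emptyG _ _ = false

addEdge : ∀ {m n} → SubK m n → Fin m → Fin n → SubK m n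
addEdge G i j i' j' = if ⌊ i ≟ i' ⌋ ∧ ⌊ j ≟ j' ⌋ then true else G i' j'

Vtx : ℕ → ℕ → Set
Vtx m n = Fin m ⊎ Fin n

Adj : ∀ {m n} → SubK m n → Vtx m n → Vtx m n → Set
Adj G (inj₁ i) (inj₂ j) = G i j ≡ true
Adj G (inj₂ j) (inj₁ i) = G i j ≡ true
Adj G (inj₁ _) (inj₁ _) = ⊥
Adj G (inj₂ _) (inj₂ _) = ⊥

HasP4 : ∀ {m n} → SubK m n → Set
HasP4 {m} {n} G = Σ (Vtx m n) λ a → Σ (Vtx m n) λ b → Σ (Vtx m n) λ c → Σ (Vtx m n) λ d →
  (a ≢ b) × (a ≢ c) × (a ≢ d) × (b ≢ c) × (b ≢ d) × (c ≢ d) ×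
  Adj G a b × Adj G b c × Adj G c d

Legal : ∀ {m n} → SubK m n → Fin m → Fin n → Set
Legal G i j = (G i j ≡ false) × ¬ HasP4 (addEdge G i j)

-- G is P_4-saturated relative to K_{m,n} (given that G is P_4-free,
-- which is invariant along the game): no legal move remains
Saturated : ∀ {m n} → SubK m n → Set
Saturated G = ∀ i j → G i j ≡ false → HasP4 (addEdge G i j)

data Player : Set where
  Max Min : Player

-- AtLeast p G k : starting from position G with player p to move,
-- Max has a strategy guaranteeing that at least k more edges are played.
data AtLeast {m n : ℕ} : Player → SubK m n → ℕ → Set where
  base  : ∀ {p G} → AtLeast p G zero
  maxMv : ∀ {G k} i j → Legal G i j → AtLeast Min (addEdge G i j) k →
          AtLeast Max G (suc k)
  minMv : ∀ {G k} → ¬ Saturated G →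
          (∀ i j → Legal G i j → AtLeast Max (addEdge G i j) k) →
          AtLeast Min G (suc k)

-- AtMost p G k : starting from position G with player p to move,
-- Min has a strategy guaranteeing that at most k more edges are played.
data AtMost {m n : ℕ} : Player → SubK m n → ℕ → Set where
  over  : ∀ {p G k} → Saturated G → AtMost p G k
  minMv : ∀ {G k} i j → Legal G i j → AtMost Max (addEdge G i j) k →
          AtMost Min G (suc k)
  maxMv : ∀ {G k} → (∀ i j → Legal G i j → AtMost Min (addEdge G i j) k) →
          AtMost Max G (suc k)

GameValue : ℕ → ℕ → Player → ℕ → Set
GameValue m n p k = AtLeast {m} {n} p emptyG k × AtMost {m} {n} p emptyG k

-- sat_g(P_4; K_{m,n}) = k   (Max moves first)
SatG : ℕ → ℕ → ℕ → Set
SatG m n k = GameValue m n Max k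

-- sat_g'(P_4; K_{m,n}) = k  (Min moves first)
SatG' : ℕ → ℕ → ℕ → Set
SatG' m n k = GameValue m n Min k

module Submission where

-- A bipartite graph is P₄-free exactly when every component is a star, so
-- during the game each component is an isolated vertex, a K₂, or a star
-- with at least two leaves, and a new edge is legal exactly when it joins
-- two isolated vertices, an end of a K₂ to an isolated vertex, or a star
-- centre to an isolated vertex.  The rest of the game therefore depends
-- only on the abstract position (a, b, e, hA, hB): isolated vertices in
-- each part, number of K₂'s, and whether some star is centred in A / B.
--
-- We first study the game on abstract positions: strategies for Max (make
-- stars, which absorb isolated vertices one at a time) and for Min (pair
-- isolated vertices, two per move) give the six cases for the starting
-- position.  A labelling of the vertices by roles then shows that abstract
-- moves and legal edges correspond, so the values transfer to K_{m,n}.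

open import Defs
open import Data.Nat using (ℕ; zero; suc; _+_; _*_; _∸_; _≤_; _<_; _>_; z≤n; s≤s; s≤s⁻¹; ⌊_/2⌋; ⌈_/2⌉)
open import Data.Nat.Properties hiding (_≟_)
open import Data.Nat.DivMod using (_/_; _%_; %-distribˡ-*; m/n≡1+[m∸n]/n)
open import Data.Fin using (Fin; _≟_) renaming (zero to fz; suc to fs)
open import Data.Bool using (Bool; true; false; if_then_else_)
open import Data.Product using (_×_; _,_; proj₁; proj₂; Σ)
open import Data.Sum using (_⊎_; inj₁; inj₂)
open import Data.Sum.Properties using (inj₁-injective; inj₂-injective)
open import Data.Empty using (⊥; ⊥-elim)
open import Data.Unit using (⊤; tt)
open import Relation.Nullary using (¬_; yes; no; Dec)
open import Relation.Nullary.Decidable using (⌊_⌋)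
open import Relation.Binary.PropositionalEquality using (_≡_; _≢_; refl; sym; trans; cong; cong₂; subst; module ≡-Reasoning)

data Pos : Set where
  pos : (a b e : ℕ) (hA hB : Bool) → Pos

data Move : Pos → Pos → Set where
  pairIso   : ∀ {a b e hA hB} → Move (pos (suc a) (suc b) e hA hB) (pos a b (suc e) hA hB)
  -- join the A end of a K₂ to an isolated B vertex: a new star centred in A
  k2ToStarᴬ : ∀ {a b e hA hB} → Move (pos a (suc b) (suc e) hA hB) (pos a b e true hB)
  -- join the B end of a K₂ to an isolated A vertex: a new star centred in B
  k2ToStarᴮ : ∀ {a b e hA hB} → Move (pos (suc a) b (suc e) hA hB) (pos a b e hA true)
  growStarᴬ : ∀ {a b e hB} → Move (pos a (suc b) e true hB) (pos a b e true hB)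
  growStarᴮ : ∀ {a b e hA} → Move (pos (suc a) b e hA true) (pos a b e hA true)

Final : Pos → Set
Final s = ∀ {s'} → Move s s' → ⊥

data AtLeastᵃ : Player → Pos → ℕ → Set where
  stop     : ∀ {p s} → AtLeastᵃ p s 0
  maxPlays : ∀ {s s' k} → Move s s' → AtLeastᵃ Min s' k → AtLeastᵃ Max s (suc k)
  minPlays : ∀ {s s' k} → Move s s' → (∀ {s''} → Move s s'' → AtLeastᵃ Max s'' k) →
             AtLeastᵃ Min s (suc k)

data AtMostᵃ : Player → Pos → ℕ → Set where
  ended    : ∀ {p s k} → Final s → AtMostᵃ p s k
  minPlays : ∀ {s s' k} → Move s s' → AtMostᵃ Max s' k → AtMostᵃ Min s (suc k)
  maxPlays : ∀ {s k} → (∀ {s'} → Move s s' → AtMostᵃ Min s' k) → AtMostᵃ Max s (suc k)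

atLeastᵃ-weaken : ∀ {p s k j} → AtLeastᵃ p s k → j ≤ k → AtLeastᵃ p s j
atLeastᵃ-weaken r z≤n = stop
atLeastᵃ-weaken (maxPlays mv r) (s≤s j≤k) = maxPlays mv (atLeastᵃ-weaken r j≤k)
atLeastᵃ-weaken (minPlays mv r) (s≤s j≤k) = minPlays mv (λ mv' → atLeastᵃ-weaken (r mv') j≤k)

atMostᵃ-weaken : ∀ {p s k j} → AtMostᵃ p s k → k ≤ j → AtMostᵃ p s j
atMostᵃ-weaken (ended fin) k≤j = ended fin
atMostᵃ-weaken (minPlays mv r) (s≤s k≤j) = minPlays mv (atMostᵃ-weaken r k≤j)
atMostᵃ-weaken (maxPlays r) (s≤s k≤j) = maxPlays (λ mv → atMostᵃ-weaken (r mv) k≤j)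

mirror : Pos → Pos
mirror (pos a b e hA hB) = pos b a e hB hA

mirror-involutive : ∀ s → mirror (mirror s) ≡ s
mirror-involutive (pos a b e hA hB) = refl

move-mirror : ∀ {s s'} → Move s s' → Move (mirror s) (mirror s')
move-mirror pairIso   = pairIso
move-mirror k2ToStarᴬ = k2ToStarᴮ
move-mirror k2ToStarᴮ = k2ToStarᴬ
move-mirror growStarᴬ = growStarᴮ
move-mirror growStarᴮ = growStarᴬ

move-unmirror : ∀ {s s'} → Move (mirror s) s' → Move s (mirror s')
move-unmirror {s} {s'} mv = subst (λ z → Move z (mirror s')) (mirror-involutive s) (move-mirror mv)

final-mirror : ∀ {s} → Final s → Final (mirror s)
final-mirror fin mv = fin (move-unmirror mv)

atLeastᵃ-mirror : ∀ {p s k} → AtLeastᵃ p s k → AtLeastᵃ p (mirror s) k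
atLeastᵃ-mirror stop = stop
atLeastᵃ-mirror (maxPlays mv r) = maxPlays (move-mirror mv) (atLeastᵃ-mirror r)
atLeastᵃ-mirror (minPlays mv r) = minPlays (move-mirror mv) λ {s'} mv' →
  subst (λ z → AtLeastᵃ Max z _) (mirror-involutive s') (atLeastᵃ-mirror (r (move-unmirror mv')))

atMostᵃ-mirror : ∀ {p s k} → AtMostᵃ p s k → AtMostᵃ p (mirror s) k
atMostᵃ-mirror (ended fin) = ended (final-mirror fin)
atMostᵃ-mirror (minPlays mv r) = minPlays (move-mirror mv) (atMostᵃ-mirror r)
atMostᵃ-mirror (maxPlays r) = maxPlays λ {s'} mv →
  subst (λ z → AtMostᵃ Min z _) (mirror-involutive s') (atMostᵃ-mirror (r (move-unmirror mv)))

Even : ℕ → Set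
Even zero = ⊤
Even (suc zero) = ⊥
Even (suc (suc n)) = Even n

Odd : ℕ → Set
Odd n = Even (suc n)

even⊎odd : ∀ n → Even n ⊎ Odd n
even⊎odd zero = inj₁ tt
even⊎odd (suc zero) = inj₂ tt
even⊎odd (suc (suc n)) = even⊎odd n

¬even-both : ∀ n → Even n → Even (suc n) → ⊥
¬even-both (suc (suc n)) v v' = ¬even-both n v v'

⌊suc/2⌋-even : ∀ n → Even n → ⌊ suc n /2⌋ ≡ ⌊ n /2⌋
⌊suc/2⌋-even zero _ = refl
⌊suc/2⌋-even (suc (suc n)) v = cong suc (⌊suc/2⌋-even n v)

⌊suc/2⌋-odd : ∀ n → Odd n → ⌊ suc n /2⌋ ≡ suc ⌊ n /2⌋
⌊suc/2⌋-odd (suc zero) _ = refl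
⌊suc/2⌋-odd (suc (suc n)) o = cong suc (⌊suc/2⌋-odd n o)

⌊suc/2⌋≤ : ∀ n → ⌊ suc n /2⌋ ≤ n
⌊suc/2⌋≤ n = s≤s⁻¹ (⌊n/2⌋<n n)

⌊/2⌋+≤⌈/2⌉+ : ∀ b a → ⌊ b /2⌋ + a ≤ ⌈ b /2⌉ + a
⌊/2⌋+≤⌈/2⌉+ b a = +-monoˡ-≤ a (⌊n/2⌋≤⌈n/2⌉ b)

≤-pred-+suc : ∀ {k} x y → suc k ≤ x + suc y → k ≤ x + y
≤-pred-+suc {k} x y h = s≤s⁻¹ (subst (suc k ≤_) (+-suc x y) h)

+-suc-comm : ∀ x y → x + suc y ≡ y + suc x
+-suc-comm x y = trans (+-comm x (suc y)) (sym (+-suc y x))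

≤-suc-cases : ∀ {b a} → b ≤ suc a → b ≤ a ⊎ b ≡ suc a
≤-suc-cases b≤1+a with m≤n⇒m<n∨m≡n b≤1+a
... | inj₁ b<1+a = inj₁ (s≤s⁻¹ b<1+a)
... | inj₂ b≡1+a = inj₂ b≡1+a

-- While a star is centred in A, every isolated B vertex will be used up:
-- Max can always give the star a new leaf, and no move destroys it.
starᴬ-fills : ∀ k {a b e hB} → k ≤ b → ∀ p → AtLeastᵃ p (pos a b e true hB) k
starᴬ-fills zero _ p = stop
starᴬ-fills (suc k) {b = suc b} k<b Max = maxPlays growStarᴬ (starᴬ-fills k (s≤s⁻¹ k<b) Min)
starᴬ-fills (suc k) {a} {suc b} {e} {hB} k<b Min = minPlays growStarᴬ reply
  where
  reply : ∀ {s} → Move (pos a (suc b) e true hB) s → AtLeastᵃ Max s k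
  reply pairIso   = starᴬ-fills k (s≤s⁻¹ k<b) Max
  reply k2ToStarᴬ = starᴬ-fills k (s≤s⁻¹ k<b) Max
  reply k2ToStarᴮ = starᴬ-fills k (<⇒≤ k<b) Max
  reply growStarᴬ = starᴬ-fills k (s≤s⁻¹ k<b) Max
  reply growStarᴮ = starᴬ-fills k (<⇒≤ k<b) Max

starᴮ-fills : ∀ k {a b e hA} → k ≤ a → ∀ p → AtLeastᵃ p (pos a b e hA true) k
starᴮ-fills k k≤a p = atLeastᵃ-mirror (starᴬ-fills k k≤a p)

-- With stars centred on both sides every isolated vertex can be absorbed;
-- Min's pairings waste at most half of the isolated B vertices.
bothStars-max : ∀ k a b e → k ≤ ⌈ b /2⌉ + a → AtLeastᵃ Max (pos a b e true true) k
bothStars-min : ∀ k a b e → k ≤ ⌊ b /2⌋ + a → AtLeastᵃ Min (pos a b e true true) k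
bothStars-reply : ∀ k a b e → suc k ≤ ⌊ b /2⌋ + a →
                  ∀ {s} → Move (pos a b e true true) s → AtLeastᵃ Max s k

bothStars-max zero a b e _ = stop
bothStars-max (suc k) a (suc b) e h = maxPlays growStarᴬ (bothStars-min k a b e (s≤s⁻¹ h))
bothStars-max (suc k) (suc a) zero e h = maxPlays growStarᴮ (bothStars-min k a zero e (s≤s⁻¹ h))

bothStars-min zero a b e _ = stop
bothStars-min (suc k) a (suc b) e h = minPlays growStarᴬ (bothStars-reply k a (suc b) e h)
bothStars-min (suc k) (suc a) zero e h = minPlays growStarᴮ (bothStars-reply k (suc a) zero e h)

bothStars-reply k (suc a) (suc b) e h pairIso = bothStars-max k a b (suc e) (≤-pred-+suc ⌈ b /2⌉ a h)
bothStars-reply k a (suc b) (suc e) h k2ToStarᴬ = bothStars-max k a b e (<⇒≤ h)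
bothStars-reply k (suc a) b (suc e) h k2ToStarᴮ =
  bothStars-max k a b e (≤-trans (≤-pred-+suc ⌊ b /2⌋ a h) (⌊/2⌋+≤⌈/2⌉+ b a))
bothStars-reply k a (suc b) e h growStarᴬ = bothStars-max k a b e (<⇒≤ h)
bothStars-reply k (suc a) b e h growStarᴮ =
  bothStars-max k a b e (≤-trans (≤-pred-+suc ⌊ b /2⌋ a h) (⌊/2⌋+≤⌈/2⌉+ b a))

-- The bounds depend
-- on the parity of b (isolated B vertices): Max wants to leave Min facing
-- an even b.  MinCond b e is the condition under which Min, to move, still
-- cannot push the game below ⌊ b /2⌋ + a further moves.
MinCond : ℕ → ℕ → Set
MinCond b e = (Even b × (1 ≤ b ⊎ 1 ≤ e)) ⊎ (2 ≤ e)

minCond-odd : ∀ {b e} → MinCond (suc b) e → Even b → 2 ≤ e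
minCond-odd {b} (inj₁ (v' , _)) v = ⊥-elim (¬even-both b v v')
minCond-odd (inj₂ 2≤e) _ = 2≤e

bound-⌊suc/2⌋ : ∀ {k} b → k ≤ ⌊ suc b /2⌋ + 0 → k ≤ b
bound-⌊suc/2⌋ {k} b h = ≤-trans (subst (k ≤_) (+-identityʳ _) h) (⌊suc/2⌋≤ b)

starᴬOnly-max₀ : ∀ k a b → Odd b → k ≤ ⌊ b /2⌋ + a → AtLeastᵃ Max (pos a b 0 true false) k
starᴬOnly-max₁ : ∀ k a b e → Odd b → k ≤ ⌈ b /2⌉ + a → AtLeastᵃ Max (pos a b (suc e) true false) k
starᴬOnly-maxEven : ∀ k a b e → Even b → k ≤ ⌊ b /2⌋ + suc a →
                    AtLeastᵃ Max (pos (suc a) b (suc e) true false) k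
starᴬOnly-min : ∀ k a b e → MinCond b e → k ≤ ⌊ b /2⌋ + a → AtLeastᵃ Min (pos a b e true false) k
-- Max to move after Min used up an isolated B vertex.
starᴬOnly-afterB : ∀ k a b e → (Even b → 1 ≤ e) → suc k ≤ ⌊ suc b /2⌋ + a →
                   AtLeastᵃ Max (pos a b e true false) k
-- Max to move after Min paired two isolated vertices.
starᴬOnly-afterPair : ∀ k a b e → suc k ≤ ⌊ suc b /2⌋ + suc a →
                      AtLeastᵃ Max (pos a b (suc e) true false) k
starᴬOnly-reply : ∀ k a b e → MinCond b e → suc k ≤ ⌊ b /2⌋ + a →
                  ∀ {s} → Move (pos a b e true false) s → AtLeastᵃ Max s k

starᴬOnly-max₀ zero a b o h = stop
starᴬOnly-max₀ (suc k) (suc a) (suc zero) o h =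
  maxPlays pairIso (starᴬOnly-min k a 0 1 (inj₁ (tt , inj₂ (s≤s z≤n))) (s≤s⁻¹ h))
starᴬOnly-max₀ (suc k) a (suc (suc b)) o h =
  maxPlays growStarᴬ (starᴬOnly-min k a (suc b) 0 (inj₁ (o , inj₁ (s≤s z≤n)))
    (subst (λ z → k ≤ z + a) (sym (⌊suc/2⌋-odd b o)) (<⇒≤ h)))

starᴬOnly-max₁ zero a b e o h = stop
starᴬOnly-max₁ (suc k) a (suc b) e o h =
  maxPlays growStarᴬ (starᴬOnly-min k a b (suc e) (inj₁ (o , inj₂ (s≤s z≤n))) (s≤s⁻¹ h))

starᴬOnly-maxEven zero a b e v h = stop
starᴬOnly-maxEven (suc k) a b e v h =
  maxPlays k2ToStarᴮ (bothStars-min k a b e (≤-pred-+suc ⌊ b /2⌋ a h))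

starᴬOnly-min zero a b e ok h = stop
starᴬOnly-min (suc k) a (suc b) e ok h = minPlays growStarᴬ (starᴬOnly-reply k a (suc b) e ok h)
starᴬOnly-min (suc k) (suc a) zero (suc e) ok h =
  minPlays k2ToStarᴮ (starᴬOnly-reply k (suc a) zero (suc e) ok h)
starᴬOnly-min (suc k) a zero zero (inj₁ (_ , inj₁ ())) h
starᴬOnly-min (suc k) a zero zero (inj₁ (_ , inj₂ ())) h
starᴬOnly-min (suc k) a zero zero (inj₂ ()) h

starᴬOnly-afterB k a b e c h with even⊎odd b
starᴬOnly-afterB k a b zero c h | inj₂ o =
  starᴬOnly-max₀ k a b o (s≤s⁻¹ (subst (λ z → suc k ≤ z + a) (⌊suc/2⌋-odd b o) h))
starᴬOnly-afterB k a b (suc e) c h | inj₂ o = starᴬOnly-max₁ k a b e o (<⇒≤ h)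
starᴬOnly-afterB k zero b e c h | inj₁ v = starᴬ-fills k (bound-⌊suc/2⌋ b (<⇒≤ h)) Max
starᴬOnly-afterB k (suc a) b (suc e) c h | inj₁ v =
  starᴬOnly-maxEven k a b e v (<⇒≤ (subst (λ z → suc k ≤ z + suc a) (⌊suc/2⌋-even b v) h))
starᴬOnly-afterB k (suc a) b zero c h | inj₁ v with c v
... | ()

starᴬOnly-afterPair k a b e h with even⊎odd b
starᴬOnly-afterPair k a b e h | inj₂ o = starᴬOnly-max₁ k a b e o (≤-pred-+suc ⌊ suc b /2⌋ a h)
starᴬOnly-afterPair k zero b e h | inj₁ v =
  starᴬ-fills k (bound-⌊suc/2⌋ b (≤-pred-+suc ⌊ suc b /2⌋ 0 h)) Max
starᴬOnly-afterPair k (suc a) b e h | inj₁ v =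
  starᴬOnly-maxEven k a b e v (subst (λ z → k ≤ z + suc a) (⌊suc/2⌋-even b v) (≤-pred-+suc ⌊ suc b /2⌋ (suc a) h))

starᴬOnly-reply k (suc a) (suc b) e ok h pairIso = starᴬOnly-afterPair k a b e h
starᴬOnly-reply k a (suc b) (suc e) ok h k2ToStarᴬ = starᴬOnly-afterB k a b e (λ v → s≤s⁻¹ (minCond-odd ok v)) h
starᴬOnly-reply k (suc a) b (suc e) ok h k2ToStarᴮ =
  bothStars-max k a b e (≤-trans (≤-pred-+suc ⌊ b /2⌋ a h) (⌊/2⌋+≤⌈/2⌉+ b a))
starᴬOnly-reply k a (suc b) e ok h growStarᴬ = starᴬOnly-afterB k a b e (λ v → <⇒≤ (minCond-odd ok v)) h

starᴬOnly-mirror-min : ∀ k a b e → MinCond b e → k ≤ ⌊ b /2⌋ + a → AtLeastᵃ Min (pos b a e false true) k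
starᴬOnly-mirror-min k a b e ok h = atLeastᵃ-mirror (starᴬOnly-min k a b e ok h)

starᴬOnly-mirror-max₀ : ∀ k a b → Odd b → k ≤ ⌊ b /2⌋ + a → AtLeastᵃ Max (pos b a 0 false true) k
starᴬOnly-mirror-max₀ k a b o h = atLeastᵃ-mirror (starᴬOnly-max₀ k a b o h)

-- Positions with a star centred in B and none in A, where the A side is
-- at least as large: Max can force every isolated A vertex and half of the
-- isolated B vertices to be used.
starᴮOnly-max₁ : ∀ k a b e → k ≤ ⌈ suc b /2⌉ + a → AtLeastᵃ Max (pos a (suc b) (suc e) false true) k
starᴮOnly-max₁ zero a b e h = stop
starᴮOnly-max₁ (suc k) a b e h = maxPlays k2ToStarᴬ (bothStars-min k a b e (s≤s⁻¹ h))

starᴮOnly-max₀ : ∀ k a b → Odd a → b ≤ a → k ≤ ⌊ b /2⌋ + a → AtLeastᵃ Max (pos a b 0 false true) k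
starᴮOnly-min : ∀ k a b e → b ≤ a → (Even a ⊎ 2 ≤ e) → k ≤ ⌊ b /2⌋ + a →
                AtLeastᵃ Min (pos a b e false true) k
-- Max to move after Min absorbed an isolated A vertex.
starᴮOnly-afterA : ∀ k a b → Odd a → suc b ≤ suc a → suc k ≤ ⌊ suc b /2⌋ + suc a →
                   AtLeastᵃ Max (pos a (suc b) 0 false true) k
starᴮOnly-reply : ∀ k a b e → suc b ≤ suc a → (Even (suc a) ⊎ 2 ≤ e) → suc k ≤ ⌊ suc b /2⌋ + suc a →
                  ∀ {s} → Move (pos (suc a) (suc b) e false true) s → AtLeastᵃ Max s k

starᴮOnly-max₀ zero a b o b≤a h = stop
starᴮOnly-max₀ (suc k) (suc a) b o b≤a h = maxPlays growStarᴮ (afterGrow a b o h (≤-suc-cases b≤a))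
  where
  afterGrow : ∀ a b → Odd (suc a) → suc k ≤ ⌊ b /2⌋ + suc a → b ≤ a ⊎ b ≡ suc a →
              AtLeastᵃ Min (pos a b 0 false true) k
  afterGrow a b o h (inj₁ b≤a) = starᴮOnly-min k a b 0 b≤a (inj₁ o) (≤-pred-+suc ⌊ b /2⌋ a h)
  afterGrow zero .1 o h (inj₂ refl) = atLeastᵃ-weaken stop (s≤s⁻¹ h)
  afterGrow (suc a) .(suc (suc a)) o h (inj₂ refl) =
    starᴬOnly-mirror-min k (suc (suc a)) (suc a) 0 (inj₁ (o , inj₁ (s≤s z≤n)))
      (<⇒≤ (subst (λ z → suc k ≤ z + suc (suc a)) (⌊suc/2⌋-even (suc a) o) h))

starᴮOnly-min zero a b e b≤a c h = stop
starᴮOnly-min (suc k) a zero e b≤a c h = starᴮ-fills (suc k) h Min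
starᴮOnly-min (suc k) (suc a) (suc b) e b≤a c h = minPlays growStarᴮ (starᴮOnly-reply k a b e b≤a c h)

starᴮOnly-afterA k a b o b≤a h with ≤-suc-cases b≤a
... | inj₁ b<a = starᴮOnly-max₀ k a (suc b) o b<a (≤-pred-+suc ⌊ suc b /2⌋ a h)
... | inj₂ refl = starᴬOnly-mirror-max₀ k (suc a) a o (s≤s⁻¹ (subst (λ z → suc k ≤ z + suc a) (⌊suc/2⌋-odd a o) h))

starᴮOnly-reply k a zero e b≤a c h pairIso = starᴮ-fills k (s≤s⁻¹ h) Max
starᴮOnly-reply k a (suc b) e b≤a c h pairIso = starᴮOnly-max₁ k a b e (≤-pred-+suc ⌊ suc (suc b) /2⌋ a h)
starᴮOnly-reply k a b (suc e) b≤a c h k2ToStarᴬ = bothStars-max k (suc a) b e (<⇒≤ h)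
starᴮOnly-reply k a b (suc (suc e)) b≤a c h k2ToStarᴮ =
  starᴮOnly-max₁ k a b e (≤-trans (≤-pred-+suc ⌊ suc b /2⌋ a h) (⌊/2⌋+≤⌈/2⌉+ (suc b) a))
starᴮOnly-reply k a b (suc zero) b≤a (inj₁ v) h k2ToStarᴮ = starᴮOnly-afterA k a b v b≤a h
starᴮOnly-reply k a b (suc zero) b≤a (inj₂ (s≤s ())) h k2ToStarᴮ
starᴮOnly-reply k a b (suc e) b≤a c h growStarᴮ =
  starᴮOnly-max₁ k a b e (≤-trans (≤-pred-+suc ⌊ suc b /2⌋ a h) (⌊/2⌋+≤⌈/2⌉+ (suc b) a))
starᴮOnly-reply k a b zero b≤a (inj₁ v) h growStarᴮ = starᴮOnly-afterA k a b v b≤a h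
starᴮOnly-reply k a b zero b≤a (inj₂ ()) h growStarᴮ

-- With no K₂, no star centred in B and an odd number of isolated B
-- vertices, Max to move can force a further moves: he pairs, and
-- afterwards always answers by creating or using a star centred in B.
oddB-maxGetsA : ∀ k a b hA → Odd b → k ≤ a → AtLeastᵃ Max (pos a b 0 hA false) k
oddB-afterPair : ∀ k a b hA → Even b → k ≤ a → AtLeastᵃ Min (pos a b 1 hA false) k
oddB-reply : ∀ k a b hA → Even b → suc k ≤ suc a →
             ∀ {s} → Move (pos (suc a) b 1 hA false) s → AtLeastᵃ Max s k

oddB-maxGetsA zero a b hA o h = stop
oddB-maxGetsA (suc k) (suc a) (suc b) hA o h = maxPlays pairIso (oddB-afterPair k a b hA o (s≤s⁻¹ h))

oddB-afterPair zero a b hA v h = stop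
oddB-afterPair (suc k) (suc a) b hA v h = minPlays k2ToStarᴮ (oddB-reply k a b hA v h)

oddB-reply zero a b hA v h mv = stop
oddB-reply (suc k) zero b hA v (s≤s ()) pairIso
oddB-reply (suc k) (suc a) b hA v h pairIso = maxPlays k2ToStarᴮ (starᴮ-fills k (s≤s⁻¹ (s≤s⁻¹ h)) Min)
oddB-reply k a b hA v h k2ToStarᴬ = oddB-maxGetsA k (suc a) _ true v (<⇒≤ h)
oddB-reply k a b hA v h k2ToStarᴮ = starᴮ-fills k (s≤s⁻¹ h) Max
oddB-reply (suc k) a b hA v h growStarᴬ = maxPlays k2ToStarᴮ (starᴮ-fills k (<⇒≤ (s≤s⁻¹ h)) Min)

-- With no K₂, no star centred in B and an even number b of isolated B
-- vertices, Min can hold Max (to move) to b further moves: she answers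
-- each move by using a second isolated B vertex, turning Max's new K₂
-- into an A-centred star or growing the A-centred star Max just grew.
evenB-cap : ∀ b → Even b → ∀ a hA → AtMostᵃ Max (pos a b 0 hA false) b
evenB-cap zero _ a hA = ended (λ ())
evenB-cap (suc (suc b)) v a hA = maxPlays reply
  where
  reply : ∀ {s} → Move (pos a (suc (suc b)) 0 hA false) s → AtMostᵃ Min s (suc b)
  reply (pairIso {a = a'}) = minPlays k2ToStarᴬ (evenB-cap b v a' true)
  reply growStarᴬ = minPlays growStarᴬ (evenB-cap b v a true)

evenA-cap : ∀ a → Even a → ∀ b hB → AtMostᵃ Max (pos a b 0 false hB) a
evenA-cap a v b hB = atMostᵃ-mirror (evenB-cap a v b hB)

-- Min's greedy strategy: pair two isolated vertices whenever possible,
-- otherwise use an isolated A vertex.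
greedy-max : ∀ k a b e hA hB → b ≤ a → ⌈ b /2⌉ + a ≤ k → AtMostᵃ Max (pos a b e hA hB) k
greedy-min : ∀ k a b e hA hB → b ≤ a → ⌊ b /2⌋ + a ≤ k → AtMostᵃ Min (pos a b e hA hB) k
-- Min to move after Max used up an isolated A vertex.
greedy-afterA : ∀ k a b {e hA} → b ≤ a ⊎ b ≡ suc a → ⌈ b /2⌉ + suc a ≤ suc k →
                AtMostᵃ Min (pos a b e hA true) k

greedy-max zero zero zero e hA hB b≤a h = ended (λ ())
greedy-max (suc k) a b e hA hB b≤a h = maxPlays reply
  where
  reply : ∀ {s} → Move (pos a b e hA hB) s → AtMostᵃ Min s k
  reply (pairIso {a = a'} {b = b'}) = greedy-min k a' b' _ hA hB (s≤s⁻¹ b≤a)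
    (≤-trans (m≤n+m _ 1) (s≤s⁻¹ (subst (_≤ suc k) (+-suc (suc ⌊ b' /2⌋) a') h)))
  reply (k2ToStarᴬ {b = b'}) = greedy-min k a b' _ true hB (≤-trans (n≤1+n b') b≤a) (s≤s⁻¹ h)
  reply (growStarᴬ {b = b'}) = greedy-min k a b' _ true hB (≤-trans (n≤1+n b') b≤a) (s≤s⁻¹ h)
  reply (k2ToStarᴮ {a = a'}) = greedy-afterA k a' b (≤-suc-cases b≤a) h
  reply (growStarᴮ {a = a'}) = greedy-afterA k a' b (≤-suc-cases b≤a) h

greedy-min zero zero zero e hA hB b≤a h = ended (λ ())
greedy-min zero (suc a) b e hA hB b≤a h with ≤-trans (m≤n+m (suc a) ⌊ b /2⌋) h
... | ()
greedy-min (suc k) (suc a) (suc b) e hA hB b≤a h =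
  minPlays pairIso (greedy-max k a b (suc e) hA hB (s≤s⁻¹ b≤a) (s≤s⁻¹ (subst (_≤ suc k) (+-suc ⌈ b /2⌉ a) h)))
greedy-min (suc k) zero zero e hA hB b≤a h = ended (λ ())
greedy-min (suc k) (suc a) zero (suc e) hA hB b≤a h = minPlays k2ToStarᴮ (greedy-max k a zero e hA true z≤n (s≤s⁻¹ h))
greedy-min (suc k) (suc a) zero zero hA true b≤a h = minPlays growStarᴮ (greedy-max k a zero zero hA true z≤n (s≤s⁻¹ h))
greedy-min (suc k) (suc a) zero zero hA false b≤a h = ended (λ ())

greedy-afterA k a b (inj₁ b≤a) h = greedy-min k a b _ _ true b≤a
  (≤-trans (⌊/2⌋+≤⌈/2⌉+ b a) (s≤s⁻¹ (subst (_≤ suc k) (+-suc ⌈ b /2⌉ a) h)))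
greedy-afterA k a .(suc a) (inj₂ refl) h =
  atMostᵃ-mirror (greedy-min k (suc a) a _ true _ (n≤1+n a) (s≤s⁻¹ h))

start : ℕ → ℕ → Pos
start m n = pos m n 0 false false

Valueᵃ : Player → ℕ → ℕ → ℕ → Set
Valueᵃ p m n k = AtLeastᵃ p (start m n) k × AtMostᵃ p (start m n) k

-- Max first, lower bound n: Max pairs, then answers Min's pairings by
-- turning the new K₂ into an A-centred star, which absorbs all of B.
maxFirst≥n : ∀ m n → n ≤ m → AtLeastᵃ Max (start m n) n
maxFirst≥n m zero _ = stop
maxFirst≥n (suc m) (suc n) n≤m = maxPlays pairIso (afterPair m n (s≤s⁻¹ n≤m))
  where
  afterPair : ∀ m n → n ≤ m → AtLeastᵃ Min (pos m n 1 false false) n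
  afterPair m zero _ = stop
  afterPair (suc m) (suc n) n≤m = minPlays k2ToStarᴮ reply
    where
    reply : ∀ {s} → Move (pos (suc m) (suc n) 1 false false) s → AtLeastᵃ Max s n
    reply (pairIso {b = zero}) = stop
    reply (pairIso {b = suc n}) = maxPlays k2ToStarᴬ (starᴬ-fills n ≤-refl Min)
    reply k2ToStarᴬ = starᴬ-fills n ≤-refl Max
    reply k2ToStarᴮ = starᴮ-fills n (s≤s⁻¹ n≤m) Max

-- Max first with m, n odd: after the opening pair both parts are even.
maxFirst-oddOdd-afterPair : ∀ k x y → Even x → Even y → y ≤ x → k ≤ x + ⌊ y /2⌋ →
                            AtLeastᵃ Min (pos x y 1 false false) k
maxFirst-oddOdd-afterPair zero x y vx vy y≤x h = stop
maxFirst-oddOdd-afterPair (suc k) zero zero vx vy y≤x ()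
maxFirst-oddOdd-afterPair (suc k) (suc x) y vx vy y≤x h = minPlays k2ToStarᴮ (reply k y vy y≤x h)
  where
  reply : ∀ k y → Even y → y ≤ suc x → suc k ≤ suc x + ⌊ y /2⌋ →
          ∀ {s} → Move (pos (suc x) y 1 false false) s → AtLeastᵃ Max s k
  reply k .1 () y≤x h (pairIso {b = zero})
  reply zero y vy y≤x h (pairIso {b = suc y'}) = stop
  reply (suc k) (suc (suc y')) vy y≤x h (pairIso {b = suc y'}) =
    maxPlays k2ToStarᴬ (starᴬOnly-min k x y' 1 (inj₁ (vy , inj₂ ≤-refl))
      (subst (k ≤_) (+-comm x ⌊ y' /2⌋) (≤-pred-+suc x ⌊ y' /2⌋ (s≤s⁻¹ h))))
  reply k (suc y') vy y≤x h (k2ToStarᴬ {b = y'}) =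
    starᴬOnly-max₀ k (suc x) y' vy
      (subst (k ≤_) (+-suc-comm x ⌊ y' /2⌋) (s≤s⁻¹ (subst (λ z → suc k ≤ suc x + z) (⌊suc/2⌋-odd y' vy) h)))
  reply k y vy y≤x h k2ToStarᴮ = afterStarᴮ x y vx (≤-suc-cases y≤x) h
    where
    afterStarᴮ : ∀ x y → Even (suc x) → y ≤ x ⊎ y ≡ suc x → suc k ≤ suc x + ⌊ y /2⌋ →
                 AtLeastᵃ Max (pos x y 0 false true) k
    afterStarᴮ x y vx (inj₁ y≤x) h = starᴮOnly-max₀ k x y vx y≤x (subst (k ≤_) (+-comm x ⌊ y /2⌋) (s≤s⁻¹ h))
    afterStarᴮ x .(suc x) vx (inj₂ refl) h = starᴬOnly-mirror-max₀ k (suc x) x vx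
      (subst (k ≤_) (trans (+-suc x ⌊ x /2⌋) (+-comm (suc x) ⌊ x /2⌋))
        (s≤s⁻¹ (subst (suc k ≤_) (cong (suc x +_) (⌊suc/2⌋-odd x vx)) h)))

-- Max first, upper bound: the only opening is a pair, then Min is greedy.
maxFirst≤ : ∀ m n → 1 ≤ n → n ≤ m → AtMostᵃ Max (start m n) (m + ⌊ n /2⌋)
maxFirst≤ (suc x) (suc y) _ n≤m = maxPlays reply
  where
  reply : ∀ {s} → Move (start (suc x) (suc y)) s → AtMostᵃ Min s (x + ⌊ suc y /2⌋)
  reply pairIso = greedy-min (x + ⌊ suc y /2⌋) x y 1 false false (s≤s⁻¹ n≤m)
    (≤-trans (≤-reflexive (+-comm ⌊ y /2⌋ x)) (+-monoʳ-≤ x (⌊n/2⌋-mono (n≤1+n y))))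

-- Min first, upper bound: Min pairs, then plays greedily.
minFirst≤ : ∀ m n → 1 ≤ n → n ≤ m → AtMostᵃ Min (start m n) (m + ⌊ n /2⌋)
minFirst≤ (suc x) (suc y) _ n≤m =
  minPlays pairIso (greedy-max (x + ⌊ suc y /2⌋) x y 1 false false (s≤s⁻¹ n≤m) (≤-reflexive (+-comm ⌈ y /2⌉ x)))

-- Min first, lower bound when mn is even: after Min's pair Max makes a
-- star on the side that leaves Min facing the right parity.
minFirst-even-afterPair : ∀ x y → 2 ≤ y → y ≤ x → Odd x ⊎ Odd y → Even y ⊎ Odd y →
                          AtLeastᵃ Max (pos x y 1 false false) (x + ⌊ suc y /2⌋)
minFirst-even-afterPair x (suc y) (s≤s 1≤y) _ _ (inj₂ oy) =
  subst (AtLeastᵃ Max (pos x (suc y) 1 false false)) (sym (+-suc x ⌊ y /2⌋))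
    (maxPlays k2ToStarᴬ (starᴬOnly-min (x + ⌊ y /2⌋) x y 0 (inj₁ (oy , inj₁ 1≤y)) (≤-reflexive (+-comm x ⌊ y /2⌋))))
minFirst-even-afterPair x y _ _ (inj₂ oy) (inj₁ vy) = ⊥-elim (¬even-both y vy oy)
minFirst-even-afterPair (suc x) y _ y≤x (inj₁ ox) (inj₁ vy) with ≤-suc-cases y≤x
... | inj₂ refl = ⊥-elim (¬even-both x ox vy)
... | inj₁ y≤x' = maxPlays k2ToStarᴮ (starᴮOnly-min (x + ⌊ suc y /2⌋) x y 0 y≤x' (inj₁ ox)
                    (≤-reflexive (trans (cong (x +_) (⌊suc/2⌋-even y vy)) (+-comm x ⌊ y /2⌋))))

-- Min first with m, n odd: Min's second pair leaves Max facing odd parts.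
minFirst-oddOdd-afterTwoPairs : ∀ k x y → Odd x → Odd y → y ≤ x → k ≤ x + ⌊ y /2⌋ →
                                AtLeastᵃ Min (pos x y 2 false false) k
minFirst-oddOdd-afterTwoPairs zero x y ox oy y≤x h = stop
minFirst-oddOdd-afterTwoPairs (suc k) (suc x) y ox oy y≤x h = minPlays k2ToStarᴮ (reply k y oy h)
  where
  reply : ∀ k y → Odd y → suc k ≤ suc x + ⌊ y /2⌋ →
          ∀ {s} → Move (pos (suc x) y 2 false false) s → AtLeastᵃ Max s k
  reply zero y oy h pairIso = stop
  reply (suc k) .1 oy h (pairIso {a = zero} {b = zero}) with s≤s⁻¹ h
  ... | ()
  reply (suc k) .1 oy h (pairIso {a = suc x'} {b = zero}) =
    maxPlays k2ToStarᴮ (starᴮ-fills k (s≤s⁻¹ (s≤s⁻¹ (subst (suc (suc k) ≤_) (+-identityʳ _) h))) Min)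
  reply (suc k) .(suc (suc (suc y'))) oy h (pairIso {b = suc (suc y')}) =
    maxPlays k2ToStarᴬ (starᴬOnly-min k x (suc y') 2 (inj₂ ≤-refl)
      (subst (k ≤_) (+-comm x _) (≤-pred-+suc x _ (s≤s⁻¹ h))))
  reply k .(suc y') oy h (k2ToStarᴬ {b = y'}) =
    starᴬOnly-maxEven k x y' 0 oy
      (subst (k ≤_) (+-comm (suc x) _) (<⇒≤ (subst (λ z → suc k ≤ suc x + z) (⌊suc/2⌋-even y' oy) h)))
  reply k .(suc y') oy h (k2ToStarᴮ {b = suc y'}) =
    starᴮOnly-max₁ k x y' 0 (≤-trans (s≤s⁻¹ h) (≤-trans (≤-reflexive (+-comm x _)) (⌊/2⌋+≤⌈/2⌉+ (suc y') x)))

-- Min first on K_{m,1} and K_{m,2}: after Min's pair, Max answers every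
-- move by using an isolated A vertex.
minFirst≥m : ∀ x y → y ≤ 1 → AtLeastᵃ Min (start (suc x) (suc y)) (suc x)
minFirst≥m x y _ = minPlays pairIso λ { pairIso → usesA x }
  where
  usesA : ∀ x → AtLeastᵃ Max (pos x y 1 false false) x
  usesA zero = stop
  usesA (suc x) = maxPlays k2ToStarᴮ (starᴮ-fills x ≤-refl Min)

minFirst≤n1 : ∀ x → AtMostᵃ Min (start (suc x) 1) (suc x)
minFirst≤n1 x = minPlays pairIso (greedy-max x x 0 1 false false z≤n ≤-refl)

minFirst≤n2 : ∀ x → AtMostᵃ Min (start (suc (suc x)) 2) (suc (suc x))
minFirst≤n2 x = minPlays pairIso (maxPlays reply)
  where
  reply : ∀ {s} → Move (pos (suc x) 1 1 false false) s → AtMostᵃ Min s x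
  reply pairIso = greedy-min x x 0 2 false false z≤n ≤-refl
  reply k2ToStarᴬ = ended (λ ())
  reply k2ToStarᴮ = starᴮ-cap x
    where
    starᴮ-cap : ∀ x → AtMostᵃ Min (pos x 1 0 false true) x
    starᴮ-cap zero = ended (λ ())
    starᴮ-cap (suc x) = greedy-min (suc x) (suc x) 1 0 false true (s≤s z≤n) ≤-refl

minFirst≥oddOdd : ∀ x y → Odd x → Odd y → y ≤ x →
                  AtLeastᵃ Min (start (suc (suc x)) (suc (suc y))) (suc x + ⌊ suc (suc y) /2⌋)
minFirst≥oddOdd x y ox oy n≤m = minPlays pairIso λ { pairIso →
  subst (AtLeastᵃ Max (pos (suc x) (suc y) 1 false false)) (sym (+-suc x ⌊ y /2⌋))
    (maxPlays pairIso (minFirst-oddOdd-afterTwoPairs (x + ⌊ y /2⌋) x y ox oy n≤m ≤-refl)) }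

-- Min first with m, n odd, upper bound: Min pairs twice if allowed;
-- if Max makes a star instead, the side it faces has even size.
minFirst≤oddOdd : ∀ x w → Even x → Even w → suc (suc w) ≤ suc (suc x) →
  AtMostᵃ Min (start (suc (suc (suc x))) (suc (suc (suc w)))) (suc (suc x) + ⌊ suc (suc (suc w)) /2⌋)
minFirst≤oddOdd x w vx vw n≤m =
  minPlays pairIso (subst (AtMostᵃ Max (pos (suc (suc x)) (suc (suc w)) 1 false false))
                          (sym (+-suc (suc x) q)) (maxPlays reply))
  where
  q = ⌊ suc w /2⌋
  reply : ∀ {s} → Move (pos (suc (suc x)) (suc (suc w)) 1 false false) s → AtMostᵃ Min s (suc x + q)
  reply pairIso = greedy-min (suc x + q) (suc x) (suc w) 2 false false (s≤s⁻¹ n≤m) (≤-reflexive (+-comm q (suc x)))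
  reply k2ToStarᴬ = minPlays growStarᴬ
    (atMostᵃ-weaken (evenB-cap w vw (suc (suc x)) true) (≤-trans (s≤s⁻¹ (s≤s⁻¹ n≤m)) (m≤m+n x q)))
  reply k2ToStarᴮ = minPlays growStarᴮ (atMostᵃ-weaken (evenA-cap x vx (suc (suc w)) true) (m≤m+n x q))

value-maxFirst-evenN : ∀ m n → n ≤ m → Even n → Valueᵃ Max m n n
value-maxFirst-evenN m n n≤m vn = maxFirst≥n m n n≤m , evenB-cap n vn m false

value-maxFirst-oddN-evenM : ∀ m n → Odd n → Even m → Valueᵃ Max m n m
value-maxFirst-oddN-evenM m n on vm = oddB-maxGetsA m m n false on ≤-refl , evenA-cap m vm n false

value-maxFirst-oddOdd : ∀ m n → 1 ≤ n → n ≤ m → Odd m → Odd n → Valueᵃ Max m n (m + ⌊ n /2⌋)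
value-maxFirst-oddOdd (suc x) (suc y) 1≤n n≤m ox oy =
  maxPlays pairIso (maxFirst-oddOdd-afterPair (x + ⌊ suc y /2⌋) x y ox oy (s≤s⁻¹ n≤m)
                     (≤-reflexive (cong (x +_) (⌊suc/2⌋-even y oy)))) ,
  maxFirst≤ (suc x) (suc y) 1≤n n≤m

value-minFirst-small : ∀ m n → 1 ≤ n → n ≤ 2 → n ≤ m → Valueᵃ Min m n m
value-minFirst-small (suc x) 1 _ _ _ = minFirst≥m x 0 z≤n , minFirst≤n1 x
value-minFirst-small (suc (suc x)) 2 _ _ _ = minFirst≥m (suc x) 1 ≤-refl , minFirst≤n2 x
value-minFirst-small 1 2 _ _ (s≤s ())
value-minFirst-small (suc x) (suc (suc (suc n))) _ (s≤s (s≤s ())) _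

value-minFirst-even : ∀ m n → 2 < n → n ≤ m → Even m ⊎ Even n → Valueᵃ Min m n (m + ⌊ n /2⌋)
value-minFirst-even (suc x) (suc y) (s≤s 2≤y) n≤m par =
  minPlays pairIso (λ { pairIso → minFirst-even-afterPair x y 2≤y (s≤s⁻¹ n≤m) par (even⊎odd y) }) ,
  minFirst≤ (suc x) (suc y) (s≤s z≤n) n≤m

value-minFirst-oddOdd : ∀ m n → 2 < n → n ≤ m → Odd m → Odd n → Valueᵃ Min m n (m + ⌊ n /2⌋ ∸ 1)
value-minFirst-oddOdd (suc (suc (suc x))) (suc (suc (suc w))) _ n≤m ox ow =
  minFirst≥oddOdd (suc x) (suc w) ox ow (s≤s⁻¹ (s≤s⁻¹ n≤m)) , minFirst≤oddOdd x w ox ow (s≤s⁻¹ n≤m)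
value-minFirst-oddOdd (suc m) 1 (s≤s ()) _ _ _
value-minFirst-oddOdd 1 (suc (suc (suc n))) _ (s≤s ()) _ _

-- The role of a vertex in a star forest.  A K₂ has two edgeEnd vertices; a
-- star with at least two leaves has one centre and its leaves.
data Role : Set where
  isolated edgeEnd centre leaf : Role

_≟ʳ_ : (x y : Role) → Dec (x ≡ y)
isolated ≟ʳ isolated = yes refl
isolated ≟ʳ edgeEnd  = no λ ()
isolated ≟ʳ centre   = no λ ()
isolated ≟ʳ leaf     = no λ ()
edgeEnd  ≟ʳ isolated = no λ ()
edgeEnd  ≟ʳ edgeEnd  = yes refl
edgeEnd  ≟ʳ centre   = no λ ()
edgeEnd  ≟ʳ leaf     = no λ ()
centre   ≟ʳ isolated = no λ ()
centre   ≟ʳ edgeEnd  = no λ ()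
centre   ≟ʳ centre   = yes refl
centre   ≟ʳ leaf     = no λ ()
leaf     ≟ʳ isolated = no λ ()
leaf     ≟ʳ edgeEnd  = no λ ()
leaf     ≟ʳ centre   = no λ ()
leaf     ≟ʳ leaf     = yes refl

relabel : ∀ {m} → (Fin m → Role) → Fin m → Role → Fin m → Role
relabel f i x i' = if ⌊ i ≟ i' ⌋ then x else f i'

relabel-same : ∀ {m} (f : Fin m → Role) i x → relabel f i x i ≡ x
relabel-same f i x with i ≟ i
... | yes _ = refl
... | no i≢i = ⊥-elim (i≢i refl)

relabel-other : ∀ {m} (f : Fin m → Role) {i i'} x → i ≢ i' → relabel f i x i' ≡ f i'
relabel-other f {i} {i'} x i≢i' with i ≟ i'
... | yes i≡i' = ⊥-elim (i≢i' i≡i')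
... | no _ = refl

relabel-fsuc : ∀ {m} (f : Fin (suc m) → Role) i z i' →
               relabel f (fs i) z (fs i') ≡ relabel (λ j → f (fs j)) i z i'
relabel-fsuc f i z i' with i ≟ i'
... | yes _ = refl
... | no _ = refl

indicator : Role → Role → ℕ
indicator y x = if ⌊ y ≟ʳ x ⌋ then 1 else 0

count : ∀ {m} → (Fin m → Role) → Role → ℕ
count {zero} f x = 0
count {suc m} f x = indicator (f fz) x + count (λ i → f (fs i)) x

count-ext : ∀ {m} {f g : Fin m → Role} x → (∀ i → f i ≡ g i) → count f x ≡ count g x
count-ext {zero} x eq = refl
count-ext {suc m} x eq = cong₂ _+_ (cong (λ z → indicator z x) (eq fz)) (count-ext x (λ i → eq (fs i)))

count-relabel : ∀ {m} (f : Fin m → Role) i y z x → f i ≡ y →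
                count (relabel f i z) x + indicator y x ≡ count f x + indicator z x
count-relabel {suc m} f fz y z x refl = +-rotate (indicator z x) (count (λ i → f (fs i)) x) (indicator y x)
  where
  +-rotate : ∀ p q r → (p + q) + r ≡ (r + q) + p
  +-rotate p q r = trans (+-comm (p + q) r) (trans (cong (r +_) (+-comm p q)) (sym (+-assoc r q p)))
count-relabel {suc m} f (fs i) y z x eq = begin
  (h + count (relabel f (fs i) z ∘fs) x) + indicator y x ≡⟨ +-assoc h _ _ ⟩
  h + (count (relabel f (fs i) z ∘fs) x + indicator y x)  ≡⟨ cong (λ c → h + (c + indicator y x)) (count-ext x (relabel-fsuc f i z)) ⟩
  h + (count (relabel (f ∘fs) i z) x + indicator y x)     ≡⟨ cong (h +_) (count-relabel (f ∘fs) i y z x eq) ⟩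
  h + (count (f ∘fs) x + indicator z x)                   ≡⟨ sym (+-assoc h _ _) ⟩
  (h + count (f ∘fs) x) + indicator z x                   ∎
  where
  open ≡-Reasoning
  h = indicator (f fz) x
  _∘fs : ∀ {A : Set} → (Fin (suc m) → A) → Fin m → A
  (g ∘fs) i = g (fs i)

count-dec : ∀ {m} (f : Fin m → Role) i {y z x k} → f i ≡ y → indicator y x ≡ 1 → indicator z x ≡ 0 →
            suc k ≡ count f x → k ≡ count (relabel f i z) x
count-dec f i {y} {z} {x} {k} fi≡y y≡x z≢x ck = suc-injective (begin
  suc k                                 ≡⟨ ck ⟩
  count f x                             ≡⟨ sym (+-identityʳ _) ⟩
  count f x + 0                         ≡⟨ cong (count f x +_) (sym z≢x) ⟩
  count f x + indicator z x             ≡⟨ sym (count-relabel f i y z x fi≡y) ⟩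
  count (relabel f i z) x + indicator y x ≡⟨ cong (count (relabel f i z) x +_) y≡x ⟩
  count (relabel f i z) x + 1           ≡⟨ +-comm _ 1 ⟩
  suc (count (relabel f i z) x)         ∎)
  where open ≡-Reasoning

count-inc : ∀ {m} (f : Fin m → Role) i {y z x k} → f i ≡ y → indicator y x ≡ 0 → indicator z x ≡ 1 →
            k ≡ count f x → suc k ≡ count (relabel f i z) x
count-inc f i {y} {z} {x} {k} fi≡y y≢x z≡x ck = begin
  suc k                                 ≡⟨ cong suc ck ⟩
  suc (count f x)                       ≡⟨ +-comm 1 _ ⟩
  count f x + 1                         ≡⟨ cong (count f x +_) (sym z≡x) ⟩
  count f x + indicator z x             ≡⟨ sym (count-relabel f i y z x fi≡y) ⟩
  count (relabel f i z) x + indicator y x ≡⟨ cong (count (relabel f i z) x +_) y≢x ⟩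
  count (relabel f i z) x + 0           ≡⟨ +-identityʳ _ ⟩
  count (relabel f i z) x               ∎
  where open ≡-Reasoning

count-same : ∀ {m} (f : Fin m → Role) i {y z x k} → f i ≡ y → indicator y x ≡ 0 → indicator z x ≡ 0 →
             k ≡ count f x → k ≡ count (relabel f i z) x
count-same f i {y} {z} {x} {k} fi≡y y≢x z≢x ck = begin
  k                                     ≡⟨ ck ⟩
  count f x                             ≡⟨ sym (+-identityʳ _) ⟩
  count f x + 0                         ≡⟨ cong (count f x +_) (sym z≢x) ⟩
  count f x + indicator z x             ≡⟨ sym (count-relabel f i y z x fi≡y) ⟩
  count (relabel f i z) x + indicator y x ≡⟨ cong (count (relabel f i z) x +_) y≢x ⟩
  count (relabel f i z) x + 0           ≡⟨ +-identityʳ _ ⟩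
  count (relabel f i z) x               ∎
  where open ≡-Reasoning

count-witness : ∀ {m} (f : Fin m → Role) x k → count f x ≡ suc k → Σ (Fin m) λ i → f i ≡ x
count-witness {suc m} f x k eq with f fz ≟ʳ x
... | yes f0≡x = fz , f0≡x
... | no _ with count-witness (λ i → f (fs i)) x k eq
...   | i , fi≡x = fs i , fi≡x

count-positive : ∀ {m} {q} (f : Fin m → Role) x i → f i ≡ x → q ≡ count f x → Σ ℕ λ k → q ≡ suc k
count-positive {suc m} f x fz refl refl = count (λ i → f (fs i)) x , cong (_+ count (λ i → f (fs i)) x) (indicator-self (f fz))
  where
  indicator-self : ∀ x → indicator x x ≡ 1
  indicator-self isolated = refl
  indicator-self edgeEnd = refl
  indicator-self centre = refl
  indicator-self leaf = refl
count-positive {suc m} f x (fs i) fi≡x q≡c with count-positive (λ i → f (fs i)) x i fi≡x refl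
... | k , c≡1+k = indicator (f fz) x + k , trans q≡c (trans (cong (indicator (f fz) x +_) c≡1+k) (+-suc (indicator (f fz) x) k))

count-isolated : ∀ m → count {m} (λ _ → isolated) isolated ≡ m
count-isolated zero = refl
count-isolated (suc m) = cong suc (count-isolated m)

count-noEdge : ∀ m → count {m} (λ _ → isolated) edgeEnd ≡ 0
count-noEdge zero = refl
count-noEdge (suc m) = count-noEdge m

module _ {m n} (G : SubK m n) (i : Fin m) (j : Fin n) where
  addEdge-new : addEdge G i j i j ≡ true
  addEdge-new with i ≟ i | j ≟ j
  ... | yes _ | yes _ = refl
  ... | no i≢i | _ = ⊥-elim (i≢i refl)
  ... | yes _ | no j≢j = ⊥-elim (j≢j refl)

  addEdge-old : ∀ i' j' → G i' j' ≡ true → addEdge G i j i' j' ≡ true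
  addEdge-old i' j' g with i ≟ i' | j ≟ j'
  ... | yes _ | yes _ = refl
  ... | yes _ | no _ = g
  ... | no _ | _ = g

  addEdge-inv : ∀ i' j' → addEdge G i j i' j' ≡ true → (i ≡ i' × j ≡ j') ⊎ G i' j' ≡ true
  addEdge-inv i' j' g with i ≟ i' | j ≟ j'
  ... | yes i≡i' | yes j≡j' = inj₁ (i≡i' , j≡j')
  ... | yes _ | no _ = inj₂ g
  ... | no _ | _ = inj₂ g

  addEdge-otherRow : ∀ i' j' → i ≢ i' → addEdge G i j i' j' ≡ G i' j'
  addEdge-otherRow i' j' i≢i' with i ≟ i'
  ... | yes i≡i' = ⊥-elim (i≢i' i≡i')
  ... | no _ = refl

  addEdge-otherCol : ∀ i' j' → j ≢ j' → addEdge G i j i' j' ≡ G i' j'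
  addEdge-otherCol i' j' j≢j' with i ≟ i' | j ≟ j'
  ... | yes _ | yes j≡j' = ⊥-elim (j≢j' j≡j')
  ... | yes _ | no _ = refl
  ... | no _ | _ = refl

-- Shape r l x: a vertex of role x whose neighbourhood (in the other part,
-- whose roles are l) is r has the neighbourhood its role demands.
Shape : ∀ {n} → (Fin n → Bool) → (Fin n → Role) → Role → Set
Shape r l isolated = ∀ j → r j ≡ false
Shape r l edgeEnd  = Σ _ λ j → r j ≡ true × l j ≡ edgeEnd × (∀ j' → r j' ≡ true → j' ≡ j)
Shape r l leaf     = Σ _ λ j → r j ≡ true × l j ≡ centre × (∀ j' → r j' ≡ true → j' ≡ j)
Shape r l centre   = (∀ j → r j ≡ true → l j ≡ leaf) ×
                     (Σ _ λ j → Σ _ λ j' → j ≢ j' × r j ≡ true × r j' ≡ true)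

StarForest : ∀ {m n} → SubK m n → (Fin m → Role) → (Fin n → Role) → Set
StarForest G la lb = (∀ i → Shape (G i) lb (la i)) × (∀ j → Shape (λ i → G i j) la (lb j))

true≢false : ∀ {b} → b ≡ true → b ≡ false → ⊥
true≢false refl ()

shape-transport : ∀ {n} {r r' : Fin n → Bool} {l l' : Fin n → Role} {x x'} →
                  (∀ j → r' j ≡ r j) → x' ≡ x → (∀ j → r j ≡ true → l' j ≡ l j) →
                  Shape r l x → Shape r' l' x'
shape-transport {x = isolated} r'≡r refl _ none j = trans (r'≡r j) (none j)
shape-transport {x = edgeEnd} r'≡r refl l'≡l (j , rj , lj , only) =
  j , trans (r'≡r j) rj , trans (l'≡l j rj) lj , λ j' r'j' → only j' (trans (sym (r'≡r j')) r'j')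
shape-transport {x = leaf} r'≡r refl l'≡l (j , rj , lj , only) =
  j , trans (r'≡r j) rj , trans (l'≡l j rj) lj , λ j' r'j' → only j' (trans (sym (r'≡r j')) r'j')
shape-transport {x = centre} r'≡r refl l'≡l (leaves , j , j' , j≢j' , rj , rj') =
  (λ j'' r'j'' → let rj'' = trans (sym (r'≡r j'')) r'j'' in trans (l'≡l j'' rj'') (leaves j'' rj'')) ,
  j , j' , j≢j' , trans (r'≡r j) rj , trans (r'≡r j') rj'

shape-cast : ∀ {n} {r : Fin n → Bool} {l x x'} → x' ≡ x → Shape r l x → Shape r l x'
shape-cast refl s = s

two-neighbours⇒centre : ∀ {n} {r : Fin n → Bool} {l} x {j j'} → Shape r l x →
                        r j ≡ true → r j' ≡ true → j ≢ j' → x ≡ centre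
two-neighbours⇒centre isolated {j} none rj rj' j≢j' = ⊥-elim (true≢false rj (none j))
two-neighbours⇒centre edgeEnd (_ , _ , _ , only) rj rj' j≢j' = ⊥-elim (j≢j' (trans (only _ rj) (sym (only _ rj'))))
two-neighbours⇒centre leaf (_ , _ , _ , only) rj rj' j≢j' = ⊥-elim (j≢j' (trans (only _ rj) (sym (only _ rj'))))
two-neighbours⇒centre centre _ _ _ _ = refl

centre⇒leaf-neighbours : ∀ {n} {r : Fin n → Bool} {l} x {j} → Shape r l x → x ≡ centre → r j ≡ true → l j ≡ leaf
centre⇒leaf-neighbours centre (leaves , _) refl rj = leaves _ rj

-- A star forest has no P₄: both middle vertices of a P₄ would be centres,
-- yet they are adjacent and a centre's neighbours are leaves.
starForest-P4free : ∀ {m n} {G : SubK m n} {la lb} → StarForest G la lb → ¬ HasP4 G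
starForest-P4free {la = la} {lb} (IA , IB)
    (inj₂ _ , inj₁ i , inj₂ j , inj₁ _ , _ , a≢c , _ , _ , b≢d , _ , ab , bc , cd) =
  centre≢leaf (trans (sym j-centre) (centre⇒leaf-neighbours (la i) (IA i) i-centre bc))
  where
  i-centre = two-neighbours⇒centre (la i) (IA i) ab bc (λ eq → a≢c (cong inj₂ eq))
  j-centre = two-neighbours⇒centre (lb j) (IB j) bc cd (λ eq → b≢d (cong inj₁ eq))
  centre≢leaf : centre ≢ leaf
  centre≢leaf ()
starForest-P4free {la = la} {lb} (IA , IB)
    (inj₁ _ , inj₂ j , inj₁ i , inj₂ _ , _ , a≢c , _ , _ , b≢d , _ , ab , bc , cd) =
  centre≢leaf (trans (sym i-centre) (centre⇒leaf-neighbours (lb j) (IB j) j-centre bc))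
  where
  j-centre = two-neighbours⇒centre (lb j) (IB j) ab bc (λ eq → a≢c (cong inj₁ eq))
  i-centre = two-neighbours⇒centre (la i) (IA i) bc cd (λ eq → b≢d (cong inj₂ eq))
  centre≢leaf : centre ≢ leaf
  centre≢leaf ()

isolatedᴬ-row : ∀ {m n} {G : SubK m n} {la lb} → StarForest G la lb →
                ∀ {i} → la i ≡ isolated → ∀ j → G i j ≡ false
isolatedᴬ-row {G = G} (IA , _) {i} li = subst (Shape (G i) _) li (IA i)

isolatedᴮ-col : ∀ {m n} {G : SubK m n} {la lb} → StarForest G la lb →
                ∀ {j} → lb j ≡ isolated → ∀ i → G i j ≡ false
isolatedᴮ-col {G = G} (_ , IB) {j} lj = subst (Shape (λ i → G i j) _) lj (IB j)

isolatedᴬ-apart : ∀ {m n} {G : SubK m n} {la lb} → StarForest G la lb →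
                  ∀ {i i' j'} → la i ≡ isolated → G i' j' ≡ true → i ≢ i'
isolatedᴬ-apart I li g refl = true≢false g (isolatedᴬ-row I li _)

isolatedᴮ-apart : ∀ {m n} {G : SubK m n} {la lb} → StarForest G la lb →
                  ∀ {j i' j'} → lb j ≡ isolated → G i' j' ≡ true → j ≢ j'
isolatedᴮ-apart I lj g refl = true≢false g (isolatedᴮ-col I lj _)

addEdge-soleᴬ : ∀ {m n} (G : SubK m n) i j → (∀ j' → G i j' ≡ false) →
                ∀ j' → addEdge G i j i j' ≡ true → j' ≡ j
addEdge-soleᴬ G i j none j' g with addEdge-inv G i j i j' g
... | inj₁ (_ , j≡j') = sym j≡j'
... | inj₂ old = ⊥-elim (true≢false old (none j'))

addEdge-soleᴮ : ∀ {m n} (G : SubK m n) i j → (∀ i' → G i' j ≡ false) →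
                ∀ i' → addEdge G i j i' j ≡ true → i' ≡ i
addEdge-soleᴮ G i j none i' g with addEdge-inv G i j i' j g
... | inj₁ (i≡i' , _) = sym i≡i'
... | inj₂ old = ⊥-elim (true≢false old (none i'))

StarFlag : ∀ {m} → (Fin m → Role) → Bool → Set
StarFlag f true  = Σ _ λ i → f i ≡ centre
StarFlag f false = ∀ i → f i ≢ centre

Census : ∀ {m} → (Fin m → Role) → ℕ → ℕ → Bool → Set
Census f a e h = (a ≡ count f isolated) × (e ≡ count f edgeEnd) × StarFlag f h

Represents : ∀ {m n} → SubK m n → (Fin m → Role) → (Fin n → Role) → Pos → Set
Represents G la lb (pos a b e hA hB) = StarForest G la lb × Census la a e hA × Census lb b e hB

Models : ∀ {m n} → SubK m n → Pos → Set
Models {m} {n} G s = Σ (Fin m → Role) λ la → Σ (Fin n → Role) λ lb → Represents G la lb s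

starFlag-keep : ∀ {m} (f : Fin m → Role) i {y z} h → f i ≡ y → y ≢ centre → z ≢ centre →
                StarFlag f h → StarFlag (relabel f i z) h
starFlag-keep f i true fi≡y y≢c z≢c (i' , c) with i ≟ i'
... | yes refl = ⊥-elim (y≢c (trans (sym fi≡y) c))
... | no i≢i' = i' , trans (relabel-other f _ i≢i') c
starFlag-keep f i false fi≡y y≢c z≢c none i' with i ≟ i'
... | yes refl = z≢c
... | no _ = none i'

starFlag-set : ∀ {m} (f : Fin m → Role) i → StarFlag (relabel f i centre) true
starFlag-set f i = i , relabel-same f i centre

module PairIso {m n} {G : SubK m n} {la lb} (I : StarForest G la lb) {i j}
               (li : la i ≡ isolated) (lj : lb j ≡ isolated) where
  G' = addEdge G i j
  la' = relabel la i edgeEnd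
  lb' = relabel lb j edgeEnd

  shapesᴬ : ∀ i' → Shape (G' i') lb' (la' i')
  shapesᴬ i' = row i' (i ≟ i')
    where
    row : ∀ i' → Dec (i ≡ i') → Shape (G' i') lb' (la' i')
    row .i (yes refl) = shape-cast (relabel-same la i edgeEnd)
          (j , addEdge-new G i j , relabel-same lb j edgeEnd , addEdge-soleᴬ G i j (isolatedᴬ-row I li))
    row i' (no i≢i') = shape-transport (λ j' → addEdge-otherRow G i j i' j' i≢i') (relabel-other la edgeEnd i≢i')
          (λ j' g → relabel-other lb edgeEnd (isolatedᴮ-apart I lj g)) (proj₁ I i')

  shapesᴮ : ∀ j' → Shape (λ i' → G' i' j') la' (lb' j')
  shapesᴮ j' = col j' (j ≟ j')
    where
    col : ∀ j' → Dec (j ≡ j') → Shape (λ i' → G' i' j') la' (lb' j')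
    col .j (yes refl) = shape-cast (relabel-same lb j edgeEnd)
          (i , addEdge-new G i j , relabel-same la i edgeEnd , addEdge-soleᴮ G i j (isolatedᴮ-col I lj))
    col j' (no j≢j') = shape-transport (λ i' → addEdge-otherCol G i j i' j' j≢j') (relabel-other lb edgeEnd j≢j')
          (λ i' g → relabel-other la edgeEnd (isolatedᴬ-apart I li g)) (proj₂ I j')


-- Joining the A end i of a K₂ {i, j₀} to an isolated B vertex j: i becomes
-- a centre with the two leaves j₀ and j.
module K2ToStarᴬ {m n} {G : SubK m n} {la lb} (I : StarForest G la lb) {i j}
                 (li : la i ≡ edgeEnd) (lj : lb j ≡ isolated) where
  G' = addEdge G i j
  partner = subst (Shape (G i) lb) li (proj₁ I i)
  j₀ = proj₁ partner
  i~j₀ : G i j₀ ≡ true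
  i~j₀ = proj₁ (proj₂ partner)
  lj₀ : lb j₀ ≡ edgeEnd
  lj₀ = proj₁ (proj₂ (proj₂ partner))
  onlyJ₀ : ∀ j' → G i j' ≡ true → j' ≡ j₀
  onlyJ₀ = proj₂ (proj₂ (proj₂ partner))
  onlyI : ∀ i' → G i' j₀ ≡ true → i' ≡ i
  onlyI i' g = let only = proj₂ (proj₂ (proj₂ (subst (Shape (λ i → G i j₀) la) lj₀ (proj₂ I j₀))))
               in trans (only i' g) (sym (only i i~j₀))
  j≢j₀ : j ≢ j₀
  j≢j₀ = isolatedᴮ-apart I lj i~j₀

  la' = relabel la i centre
  lb₁ = relabel lb j leaf
  lb' = relabel lb₁ j₀ leaf
  lb₁j₀ : lb₁ j₀ ≡ edgeEnd
  lb₁j₀ = trans (relabel-other lb leaf j≢j₀) lj₀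
  lb'j : lb' j ≡ leaf
  lb'j = trans (relabel-other lb₁ leaf (λ eq → j≢j₀ (sym eq))) (relabel-same lb j leaf)
  lb'-other : ∀ j' → j ≢ j' → j₀ ≢ j' → lb' j' ≡ lb j'
  lb'-other j' j≢j' j₀≢j' = trans (relabel-other lb₁ leaf j₀≢j') (relabel-other lb leaf j≢j')

  leaves : ∀ j' → G' i j' ≡ true → lb' j' ≡ leaf
  leaves j' g with addEdge-inv G i j i j' g
  ... | inj₁ (_ , refl) = lb'j
  ... | inj₂ old = subst (λ z → lb' z ≡ leaf) (sym (onlyJ₀ j' old)) (relabel-same lb₁ j₀ leaf)

  shapesᴬ : ∀ i' → Shape (G' i') lb' (la' i')
  shapesᴬ i' = row i' (i ≟ i')
    where
    row : ∀ i' → Dec (i ≡ i') → Shape (G' i') lb' (la' i')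
    row .i (yes refl) = shape-cast (relabel-same la i centre)
          (leaves , j₀ , j , (λ eq → j≢j₀ (sym eq)) , addEdge-old G i j i j₀ i~j₀ , addEdge-new G i j)
    row i' (no i≢i') = shape-transport (λ j' → addEdge-otherRow G i j i' j' i≢i') (relabel-other la centre i≢i')
          (λ j' g → lb'-other j' (isolatedᴮ-apart I lj g) (λ { refl → i≢i' (sym (onlyI i' g)) })) (proj₁ I i')

  shapesᴮ : ∀ j' → Shape (λ i' → G' i' j') la' (lb' j')
  shapesᴮ j' = col j' (j ≟ j') (j₀ ≟ j')
    where
    col : ∀ j' → Dec (j ≡ j') → Dec (j₀ ≡ j') → Shape (λ i' → G' i' j') la' (lb' j')
    col .j (yes refl) _ = shape-cast lb'j
          (i , addEdge-new G i j , relabel-same la i centre , addEdge-soleᴮ G i j (isolatedᴮ-col I lj))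
    col .j₀ (no j≢j') (yes refl) = shape-cast (relabel-same lb₁ j₀ leaf)
          (i , addEdge-old G i j i j₀ i~j₀ , relabel-same la i centre ,
           λ i' g → onlyI i' (trans (sym (addEdge-otherCol G i j i' j₀ j≢j')) g))
    col j' (no j≢j') (no j₀≢j') = shape-transport (λ i' → addEdge-otherCol G i j i' j' j≢j') (lb'-other j' j≢j' j₀≢j')
          (λ i' g → relabel-other la centre (λ { refl → j₀≢j' (sym (onlyJ₀ j' g)) })) (proj₂ I j')


module GrowStarᴬ {m n} {G : SubK m n} {la lb} (I : StarForest G la lb) {i j}
                 (li : la i ≡ centre) (lj : lb j ≡ isolated) where
  G' = addEdge G i j
  lb' = relabel lb j leaf
  star = subst (Shape (G i) lb) li (proj₁ I i)

  leaves : ∀ j' → G' i j' ≡ true → lb' j' ≡ leaf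
  leaves j' g with addEdge-inv G i j i j' g
  ... | inj₁ (_ , refl) = relabel-same lb j leaf
  ... | inj₂ old = trans (relabel-other lb leaf (isolatedᴮ-apart I lj old)) (proj₁ star j' old)

  shapesᴬ : ∀ i' → Shape (G' i') lb' (la i')
  shapesᴬ i' = row i' (i ≟ i')
    where
    row : ∀ i' → Dec (i ≡ i') → Shape (G' i') lb' (la i')
    row .i (yes refl) with proj₂ star
    ... | j₁ , j₂ , j₁≢j₂ , g₁ , g₂ =
      shape-cast li (leaves , j₁ , j₂ , j₁≢j₂ , addEdge-old G i j i j₁ g₁ , addEdge-old G i j i j₂ g₂)
    row i' (no i≢i') = shape-transport (λ j' → addEdge-otherRow G i j i' j' i≢i') refl
          (λ j' g → relabel-other lb leaf (isolatedᴮ-apart I lj g)) (proj₁ I i')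

  shapesᴮ : ∀ j' → Shape (λ i' → G' i' j') la (lb' j')
  shapesᴮ j' = col j' (j ≟ j')
    where
    col : ∀ j' → Dec (j ≡ j') → Shape (λ i' → G' i' j') la (lb' j')
    col .j (yes refl) = shape-cast (relabel-same lb j leaf)
          (i , addEdge-new G i j , li , addEdge-soleᴮ G i j (isolatedᴮ-col I lj))
    col j' (no j≢j') = shape-transport (λ i' → addEdge-otherCol G i j i' j' j≢j') (relabel-other lb leaf j≢j')
          (λ _ _ → refl) (proj₂ I j')


Leads : ∀ {m n} → SubK m n → Fin m → Fin n → Pos → Set
Leads G i j s' = (G i j ≡ false) × Models (addEdge G i j) s'

leads-legal : ∀ {m n} (G : SubK m n) i j {s'} → Leads G i j s' → Legal G i j
leads-legal G i j {pos _ _ _ _ _} (new , _ , _ , I , _) = new , starForest-P4free I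

step-pairIso : ∀ {m n} {G : SubK m n} {la lb} {a b e hA hB} i j →
  Represents G la lb (pos (suc a) (suc b) e hA hB) → la i ≡ isolated → lb j ≡ isolated →
  Leads G i j (pos a b (suc e) hA hB)
step-pairIso {la = la} {lb} i j (I , (ca , ce , fa) , (cb , ce' , fb)) li lj =
  isolatedᴬ-row I li j , la' , lb' , (shapesᴬ , shapesᴮ) ,
  (count-dec la i li refl refl ca , count-inc la i li refl refl ce , starFlag-keep la i _ li (λ ()) (λ ()) fa) ,
  (count-dec lb j lj refl refl cb , count-inc lb j lj refl refl ce' , starFlag-keep lb j _ lj (λ ()) (λ ()) fb)
  where open PairIso I li lj

step-k2ToStarᴬ : ∀ {m n} {G : SubK m n} {la lb} {a b e hA hB} i j →
  Represents G la lb (pos a (suc b) (suc e) hA hB) → la i ≡ edgeEnd → lb j ≡ isolated →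
  Leads G i j (pos a b e true hB)
step-k2ToStarᴬ {la = la} {lb} i j (I , (ca , ce , fa) , (cb , ce' , fb)) li lj =
  isolatedᴮ-col I lj i , la' , lb' , (shapesᴬ , shapesᴮ) ,
  (count-same la i li refl refl ca , count-dec la i li refl refl ce , starFlag-set la i) ,
  (count-same lb₁ j₀ lb₁j₀ refl refl (count-dec lb j lj refl refl cb) ,
   count-dec lb₁ j₀ lb₁j₀ refl refl (count-same lb j lj refl refl ce') ,
   starFlag-keep lb₁ j₀ _ lb₁j₀ (λ ()) (λ ()) (starFlag-keep lb j _ lj (λ ()) (λ ()) fb))
  where open K2ToStarᴬ I li lj

step-growStarᴬ : ∀ {m n} {G : SubK m n} {la lb} {a b e hB} i j →
  Represents G la lb (pos a (suc b) e true hB) → la i ≡ centre → lb j ≡ isolated →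
  Leads G i j (pos a b e true hB)
step-growStarᴬ {la = la} {lb} i j (I , censusᴬ , (cb , ce' , fb)) li lj =
  isolatedᴮ-col I lj i , la , lb' , (shapesᴬ , shapesᴮ) , censusᴬ ,
  (count-dec lb j lj refl refl cb , count-same lb j lj refl refl ce' , starFlag-keep lb j _ lj (λ ()) (λ ()) fb)
  where open GrowStarᴬ I li lj

-- Transposing the graph mirrors the abstract position; this yields the
-- two B-side steps from the A-side ones.
_ᵀ : ∀ {m n} → SubK m n → SubK n m
(G ᵀ) j i = G i j

represents-transpose : ∀ {m n} {G : SubK m n} {la lb} s → Represents G la lb s → Represents (G ᵀ) lb la (mirror s)
represents-transpose (pos a b e hA hB) ((IA , IB) , censusᴬ , censusᴮ) = (IB , IA) , censusᴮ , censusᴬ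

represents-ext : ∀ {m n} {G G' : SubK m n} {la lb} s → (∀ i j → G' i j ≡ G i j) →
                 Represents G la lb s → Represents G' la lb s
represents-ext (pos a b e hA hB) G'≡G ((IA , IB) , census) =
  ((λ i → shape-transport (λ j → G'≡G i j) refl (λ _ _ → refl) (IA i)) ,
   (λ j → shape-transport (λ i → G'≡G i j) refl (λ _ _ → refl) (IB j))) , census

addEdge-transpose : ∀ {m n} (G : SubK m n) i j i' j' → addEdge (G ᵀ) j i j' i' ≡ addEdge G i j i' j'
addEdge-transpose G i j i' j' with i ≟ i' | j ≟ j'
... | yes _ | yes _ = refl
... | yes _ | no _ = refl
... | no _ | yes _ = refl
... | no _ | no _ = refl

leads-untranspose : ∀ {m n} {G : SubK m n} {i j} s' → Leads (G ᵀ) j i (mirror s') → Leads G i j s'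
leads-untranspose {G = G} {i} {j} s'@(pos _ _ _ _ _) (new , lb' , la' , r') =
  new , la' , lb' , represents-ext s' (λ i' j' → sym (addEdge-transpose G i j i' j')) (represents-transpose (mirror s') r')

step-k2ToStarᴮ : ∀ {m n} {G : SubK m n} {la lb} {a b e hA hB} i j →
  Represents G la lb (pos (suc a) b (suc e) hA hB) → la i ≡ isolated → lb j ≡ edgeEnd →
  Leads G i j (pos a b e hA true)
step-k2ToStarᴮ {G = G} i j r li lj = leads-untranspose {G = G} {i} {j} _ (step-k2ToStarᴬ j i (represents-transpose _ r) lj li)

step-growStarᴮ : ∀ {m n} {G : SubK m n} {la lb} {a b e hA} i j →
  Represents G la lb (pos (suc a) b e hA true) → la i ≡ isolated → lb j ≡ centre →
  Leads G i j (pos a b e hA true)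
step-growStarᴮ {G = G} i j r li lj = leads-untranspose {G = G} {i} {j} _ (step-growStarᴬ j i (represents-transpose _ r) lj li)

realise : ∀ {m n} {G : SubK m n} {s s'} → Models G s → Move s s' → Σ (Fin m) λ i → Σ (Fin n) λ j → Leads G i j s'
realise (la , lb , r@(_ , (ca , ce , fa) , (cb , ce' , fb))) (pairIso {a = a} {b = b})
  with count-witness la isolated a (sym ca) | count-witness lb isolated b (sym cb)
... | i , li | j , lj = i , j , step-pairIso i j r li lj
realise (la , lb , r@(_ , (ca , ce , fa) , (cb , ce' , fb))) (k2ToStarᴬ {b = b} {e = e})
  with count-witness la edgeEnd e (sym ce) | count-witness lb isolated b (sym cb)
... | i , li | j , lj = i , j , step-k2ToStarᴬ i j r li lj
realise (la , lb , r@(_ , (ca , ce , fa) , (cb , ce' , fb))) (k2ToStarᴮ {a = a} {e = e})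
  with count-witness la isolated a (sym ca) | count-witness lb edgeEnd e (sym ce')
... | i , li | j , lj = i , j , step-k2ToStarᴮ i j r li lj
realise (la , lb , r@(_ , (ca , ce , (i , li)) , (cb , ce' , fb))) (growStarᴬ {b = b})
  with count-witness lb isolated b (sym cb)
... | j , lj = i , j , step-growStarᴬ i j r li lj
realise (la , lb , r@(_ , (ca , ce , fa) , (cb , ce' , (j , lj)))) (growStarᴮ {a = a})
  with count-witness la isolated a (sym ca)
... | i , li = i , j , step-growStarᴮ i j r li lj

Outcome : ∀ {m n} → SubK m n → Fin m → Fin n → Pos → Set
Outcome G i j s = HasP4 (addEdge G i j) ⊎ Σ Pos λ s' → Move s s' × Models (addEdge G i j) s'

someNeighbour : ∀ {n} {r : Fin n → Bool} {l} x → Shape r l x → x ≡ edgeEnd ⊎ x ≡ centre → Σ _ λ j → r j ≡ true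
someNeighbour edgeEnd (j , g , _) _ = j , g
someNeighbour centre (_ , j , _ , _ , g , _) _ = j , g
someNeighbour isolated _ (inj₁ ())
someNeighbour isolated _ (inj₂ ())
someNeighbour leaf _ (inj₁ ())
someNeighbour leaf _ (inj₂ ())

otherNeighbour : ∀ {n} {r : Fin n → Bool} {l} x → Shape r l x → x ≡ centre → ∀ j → Σ _ λ j' → r j' ≡ true × j' ≢ j
otherNeighbour centre (_ , j₁ , j₂ , j₁≢j₂ , g₁ , g₂) refl j with j₁ ≟ j
... | yes refl = j₂ , g₂ , λ eq → j₁≢j₂ (sym eq)
... | no j₁≢j = j₁ , g₁ , j₁≢j

-- The edges that create a P₄: joining two non-trivial stars, or touching a leaf.
module NewP4 {m n} {G : SubK m n} {la lb} (I : StarForest G la lb) {i j} (new : G i j ≡ false) where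
  G' = addEdge G i j

  rowNe : ∀ {j'} → G i j' ≡ true → j' ≢ j
  rowNe g eq = true≢false (subst (λ z → G i z ≡ true) eq g) new
  colNe : ∀ {i'} → G i' j ≡ true → i' ≢ i
  colNe g eq = true≢false (subst (λ z → G z j ≡ true) eq g) new

  -- j' – i – j – i' with i and j in stars of size ≥ 2
  twoStars : la i ≡ edgeEnd ⊎ la i ≡ centre → lb j ≡ edgeEnd ⊎ lb j ≡ centre → HasP4 G'
  twoStars ci cj with someNeighbour (la i) (proj₁ I i) ci | someNeighbour (lb j) (proj₂ I j) cj
  ... | j' , gj' | i' , gi' =
    inj₂ j' , inj₁ i , inj₂ j , inj₁ i' , (λ ()) , (λ eq → rowNe gj' (inj₂-injective eq)) , (λ ()) , (λ ()) ,
    (λ eq → colNe gi' (sym (inj₁-injective eq))) , (λ ()) ,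
    addEdge-old G i j i j' gj' , addEdge-new G i j , addEdge-old G i j i' j gi'

  -- j – i – c – i₃ where i is a leaf of the star centred at c
  leafᴬ : la i ≡ leaf → HasP4 G'
  leafᴬ li with shape-cast (sym li) (proj₁ I i)
  ... | c , gc , lc , _ with otherNeighbour (lb c) (proj₂ I c) lc i
  ...   | i₃ , g₃ , i₃≢i =
    inj₂ j , inj₁ i , inj₂ c , inj₁ i₃ , (λ ()) , (λ eq → rowNe gc (sym (inj₂-injective eq))) , (λ ()) , (λ ()) ,
    (λ eq → i₃≢i (sym (inj₁-injective eq))) , (λ ()) ,
    addEdge-new G i j , addEdge-old G i j i c gc , addEdge-old G i j i₃ c g₃

  -- i – j – c – j₃ where j is a leaf of the star centred at c
  leafᴮ : lb j ≡ leaf → HasP4 G'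
  leafᴮ lj with shape-cast (sym lj) (proj₂ I j)
  ... | c , gc , lc , _ with otherNeighbour (la c) (proj₁ I c) lc j
  ...   | j₃ , g₃ , j₃≢j =
    inj₁ i , inj₂ j , inj₁ c , inj₂ j₃ , (λ ()) , (λ eq → colNe gc (sym (inj₁-injective eq))) , (λ ()) , (λ ()) ,
    (λ eq → j₃≢j (sym (inj₂-injective eq))) , (λ ()) ,
    addEdge-new G i j , addEdge-old G i j c j gc , addEdge-old G i j c j₃ g₃

starFlag-true : ∀ {m} (f : Fin m → Role) h i → f i ≡ centre → StarFlag f h → h ≡ true
starFlag-true f true i c _ = refl
starFlag-true f false i c none = ⊥-elim (none i c)

-- Classify a new edge by the roles of its ends; when it is a move, the
-- census shows that the position has the vertices the move consumes.
classify : ∀ {m n} {G : SubK m n} s → Models G s → ∀ i j → G i j ≡ false → Outcome G i j s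
classify {G = G} (pos a b e hA hB) (la , lb , r@(I , (ca , ce , fa) , (cb , ce' , fb))) i j new =
  byRoles (la i) (lb j) refl refl
  where
  open NewP4 I new
  move : ∀ {s'} → Move (pos a b e hA hB) s' → Leads G i j s' →
         Σ Pos λ s'' → Move (pos a b e hA hB) s'' × Models (addEdge G i j) s''
  move mv (_ , model) = _ , mv , model
  byRoles : ∀ x y → la i ≡ x → lb j ≡ y → Outcome G i j (pos a b e hA hB)
  byRoles leaf y li lj = inj₁ (leafᴬ li)
  byRoles x leaf li lj = inj₁ (leafᴮ lj)
  byRoles isolated isolated li lj with count-positive la isolated i li ca | count-positive lb isolated j lj cb
  ... | _ , refl | _ , refl = inj₂ (move pairIso (step-pairIso i j r li lj))
  byRoles isolated edgeEnd li lj with count-positive la isolated i li ca | count-positive lb edgeEnd j lj ce'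
  ... | _ , refl | _ , refl = inj₂ (move k2ToStarᴮ (step-k2ToStarᴮ i j r li lj))
  byRoles isolated centre li lj with count-positive la isolated i li ca | starFlag-true lb hB j lj fb
  ... | _ , refl | refl = inj₂ (move growStarᴮ (step-growStarᴮ i j r li lj))
  byRoles edgeEnd isolated li lj with count-positive lb isolated j lj cb | count-positive la edgeEnd i li ce
  ... | _ , refl | _ , refl = inj₂ (move k2ToStarᴬ (step-k2ToStarᴬ i j r li lj))
  byRoles centre isolated li lj with count-positive lb isolated j lj cb | starFlag-true la hA i li fa
  ... | _ , refl | refl = inj₂ (move growStarᴬ (step-growStarᴬ i j r li lj))
  byRoles edgeEnd edgeEnd li lj = inj₁ (twoStars (inj₁ li) (inj₁ lj))
  byRoles edgeEnd centre li lj = inj₁ (twoStars (inj₁ li) (inj₂ lj))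
  byRoles centre edgeEnd li lj = inj₁ (twoStars (inj₂ li) (inj₁ lj))
  byRoles centre centre li lj = inj₁ (twoStars (inj₂ li) (inj₂ lj))

atLeast-transfer : ∀ {m n} {G : SubK m n} {p s k} → Models G s → AtLeastᵃ p s k → AtLeast p G k
atLeast-transfer model stop = base
atLeast-transfer {G = G} model (maxPlays mv r) with realise model mv
... | i , j , leads@(_ , model') = maxMv i j (leads-legal G i j leads) (atLeast-transfer model' r)
atLeast-transfer {G = G} {s = s} model (minPlays mv r) = minMv notSaturated reply
  where
  notSaturated : ¬ Saturated G
  notSaturated sat with realise model mv
  ... | i , j , leads with leads-legal G i j leads
  ...   | new , p4free = p4free (sat i j new)
  reply : ∀ i j → Legal G i j → AtLeast Max (addEdge G i j) _
  reply i j (new , p4free) with classify s model i j new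
  ... | inj₁ p4 = ⊥-elim (p4free p4)
  ... | inj₂ (_ , mv' , model') = atLeast-transfer model' (r mv')

atMost-transfer : ∀ {m n} {G : SubK m n} {p s k} → Models G s → AtMostᵃ p s k → AtMost p G k
atMost-transfer {G = G} {s = s} model (ended fin) = over saturated
  where
  saturated : Saturated G
  saturated i j new with classify s model i j new
  ... | inj₁ p4 = p4
  ... | inj₂ (_ , mv , _) = ⊥-elim (fin mv)
atMost-transfer {G = G} model (minPlays mv r) with realise model mv
... | i , j , leads@(_ , model') = minMv i j (leads-legal G i j leads) (atMost-transfer model' r)
atMost-transfer {G = G} {s = s} model (maxPlays r) = maxMv reply
  where
  reply : ∀ i j → Legal G i j → AtMost Min (addEdge G i j) _
  reply i j (new , p4free) with classify s model i j new
  ... | inj₁ p4 = ⊥-elim (p4free p4)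
  ... | inj₂ (_ , mv , model') = atMost-transfer model' (r mv)

start-models : ∀ m n → Models (emptyG {m} {n}) (start m n)
start-models m n = (λ _ → isolated) , (λ _ → isolated) , ((λ i j → refl) , (λ j i → refl)) ,
  (sym (count-isolated m) , sym (count-noEdge m) , (λ i ())) ,
  (sym (count-isolated n) , sym (count-noEdge n) , (λ j ()))

gameValue : ∀ {m n p k} → Valueᵃ p m n k → GameValue m n p k
gameValue {m} {n} (lower , upper) = atLeast-transfer (start-models m n) lower , atMost-transfer (start-models m n) upper

parity : ∀ n → (n % 2 ≡ 0 × Even n) ⊎ (n % 2 ≡ 1 × Odd n)
parity zero = inj₁ (refl , tt)
parity (suc zero) = inj₂ (refl , tt)
parity (suc (suc n)) = parity n

even-of-% : ∀ n → n % 2 ≡ 0 → Even n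
even-of-% n h with parity n
... | inj₁ (_ , v) = v
... | inj₂ (n%2≡1 , _) with trans (sym h) n%2≡1
...   | ()

odd-of-% : ∀ n → n % 2 ≡ 1 → Odd n
odd-of-% n h with parity n
... | inj₂ (_ , o) = o
... | inj₁ (n%2≡0 , _) with trans (sym h) n%2≡0
...   | ()

-- The parity of a product, via (m * n) % 2 ≡ ((m % 2) * (n % 2)) % 2.
odd-product : ∀ m n → (m * n) % 2 ≡ 1 → Odd m × Odd n
odd-product m n h with parity m | parity n
... | inj₂ (_ , om) | inj₂ (_ , on) = om , on
... | inj₁ (m0 , _) | _ with trans (sym h) (trans (%-distribˡ-* m n 2) (cong (λ r → (r * (n % 2)) % 2) m0))
...   | ()
odd-product m n h | inj₂ (m1 , _) | inj₁ (n0 , _)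
  with trans (sym h) (trans (%-distribˡ-* m n 2) (cong₂ (λ r s → (r * s) % 2) m1 n0))
... | ()

even-product : ∀ m n → (m * n) % 2 ≡ 0 → Even m ⊎ Even n
even-product m n h with parity m | parity n
... | inj₁ (_ , vm) | _ = inj₁ vm
... | inj₂ _ | inj₁ (_ , vn) = inj₂ vn
... | inj₂ (m1 , _) | inj₂ (n1 , _) with trans (sym h) (trans (%-distribˡ-* m n 2) (cong₂ (λ r s → (r * s) % 2) m1 n1))
...   | ()

n/2≡⌊n/2⌋ : ∀ n → n / 2 ≡ ⌊ n /2⌋
n/2≡⌊n/2⌋ zero = refl
n/2≡⌊n/2⌋ (suc zero) = refl
n/2≡⌊n/2⌋ (suc (suc n)) = trans (m/n≡1+[m∸n]/n {suc (suc n)} {2} (s≤s (s≤s z≤n))) (cong suc (n/2≡⌊n/2⌋ n))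

mainTheorem5 : (m n : ℕ) → 1 ≤ n → n ≤ m →
    ((n % 2 ≡ 0 → SatG m n n) ×
     (n % 2 ≡ 1 → m % 2 ≡ 0 → SatG m n m) ×
     ((m * n) % 2 ≡ 1 → SatG m n (m + n / 2))) ×
    ((n ≤ 2 → SatG' m n m) ×
     (n > 2 → (m * n) % 2 ≡ 0 → SatG' m n (m + n / 2)) ×
     (n > 2 → (m * n) % 2 ≡ 1 → SatG' m n (m + n / 2 ∸ 1)))
mainTheorem5 m n 1≤n n≤m rewrite n/2≡⌊n/2⌋ n =
  ( (λ n-even → gameValue (value-maxFirst-evenN m n n≤m (even-of-% n n-even)))
  , (λ n-odd m-even → gameValue (value-maxFirst-oddN-evenM m n (odd-of-% n n-odd) (even-of-% m m-even)))
  , (λ mn-odd → let (om , on) = odd-product m n mn-odd in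
                gameValue (value-maxFirst-oddOdd m n 1≤n n≤m om on)) )
  , ( (λ n≤2 → gameValue (value-minFirst-small m n 1≤n n≤2 n≤m))
    , (λ 2<n mn-even → gameValue (value-minFirst-even m n 2<n n≤m (even-product m n mn-even)))
    , (λ 2<n mn-odd → let (om , on) = odd-product m n mn-odd in
                      gameValue (value-minFirst-oddOdd m n 2<n n≤m om on)) )
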